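{- Let $H$ be a graph and let $A, B \subseteq V(H)$ be disjoint such that $(H,A,B)$ has property $\mathcal{P}$. Let $H^*\coloneqq H - E_H(A,B)$, $A' \coloneqq \{x \in A \colon d_{H}(x) \geq 4\}$ and $B' \coloneqq N_H(A \setminus A')$. Then (i) $S(H) = (S(H^*) \setminus B') \cup A'$; (ii) $P(H) = P(H^*) \cup B'$; (iii) $R(H) = R(H^*) \setminus A'$.
   Context: All graphs are finite and simple. For a graph $G$ and $X \subseteq V(G)$, $N_G(X) \coloneqq \{y \in V(G)\setminus X \colon y \text{ has a neighbour in } X\}$, $N_G(x) \coloneqq N_G(\{x\})$, $d_G(x)$ is the degree, $\mathrm{dist}_G$ is graph distance, $E_G(X)$ is the set of edges inside $X$, $E_G(X,Y)$ the set of edges with one end in $X$ and one in $Y$, and $G - E'$ removes the edge set $E'$. A set $X \subseteq V(G)$ has the strong $4$-core property for $G$ if $|N_G(x) \cap X| \geq 4$ for every $x \in X \cup N_G(X)$; the strong $4$-core $S(G)$ is the largest such set (the union of all such sets); $P(G) \coloneqq N_G(S(G))$ and $R(G) \coloneqq V(G) \setminus (S(G)\cup P(G))$. A set $B$ has the robust sapphire property for $G$ if (RS1) for every $x \in B \cup N_G(B)$, $\{x\} \cup N_G(x) \subseteq S(G)$ and $d_G(x) \geq 5$, and (RS2) $\mathrm{dist}_G(b_1,b_2)\geq 5$ for all distinct $b_1,b_2 \in B$. For a graph $H$ and disjoint $A,B \subseteq V(H)$, with $H^* \coloneqq H - E_H(A,B)$, the triple $(H,A,B)$ has property $\mathcal{P}$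 if: (P1) $E_H(A) = E_H(B) = \varnothing$; (P2) $H[A \cup B]$ is a union of (vertex-disjoint) stars and $|N_H(b) \cap A| \leq 1$ for each $b \in B$; (P3) every vertex of $A$ is isolated in $H^*$; (P4) $B$ has the robust sapphire property for $H^*$. -}

module Defs where

open import Data.Nat using (ℕ; zero; suc; _≤_; _<_)
open import Data.Bool using (Bool; true; false; _∧_; _∨_; not)
open import Data.Bool.Properties using (∨-comm)
open import Data.Fin using (Fin)
open import Data.Fin.Subset using (Subset; _∈_; _∉_; _∩_; ∣_∣)
open import Data.Vec using (lookup; tabulate)
open import Data.Product using (Σ; ∃; _×_; _,_)
open import Data.Sum using (_⊎_)
open import Relation.Nullary using (¬_)
open import Relation.Binary.PropositionalEquality using (_≡_; _≢_; refl; cong; cong₂)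

record Graph (n : ℕ) : Set where
  field
    adj    : Fin n → Fin n → Bool
    sym    : ∀ x y → adj x y ≡ adj y x
    irrefl : ∀ x → adj x x ≡ false
open Graph public

module _ {n : ℕ} where

  Adj : Graph n → Fin n → Fin n → Set
  Adj G x y = adj G x y ≡ true

  nbhd : Graph n → Fin n → Subset n
  nbhd G x = tabulate (adj G x)

  deg : Graph n → Fin n → ℕ
  deg G x = ∣ nbhd G x ∣

  N : Graph n → (Fin n → Set) → Fin n → Set
  N G X y = ¬ X y × ∃ λ x → X x × Adj G x y

  Strong4Core : Graph n → Subset n → Set
  Strong4Core G X = ∀ x → (x ∈ X ⊎ N G (_∈ X) x) → 4 ≤ ∣ nbhd G x ∩ X ∣

  S : Graph n → Fin n → Set
  S G x = ∃ λ (X : Subset n) → Strong4Core G X × x ∈ X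

  P : Graph n → Fin n → Set
  P G = N G (S G)

  R : Graph n → Fin n → Set
  R G x = ¬ S G x × ¬ P G x

  data Walk (G : Graph n) : Fin n → Fin n → ℕ → Set where
    here : ∀ {x} → Walk G x x zero
    step : ∀ {x y z k} → Adj G x y → Walk G y z k → Walk G x z (suc k)

  -- dist_G(x,y) ≥ d  (no walk, equivalently no path, of length < d;
  -- includes the case dist = ∞ of different components)
  DistAtLeast : Graph n → Fin n → Fin n → ℕ → Set
  DistAtLeast G x y d = ∀ k → k < d → ¬ Walk G x y k

  RobustSapphire : Graph n → Subset n → Set
  RobustSapphire G B =
    (∀ x → (x ∈ B ⊎ N G (_∈ B) x) →
       S G x × (∀ y → Adj G x y → S G y) × 5 ≤ deg G x)
    × (∀ b₁ b₂ → b₁ ∈ B → b₂ ∈ B → b₁ ≢ b₂ → DistAtLeast G b₁ b₂ 5)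

  crossAB : Subset n → Subset n → Fin n → Fin n → Bool
  crossAB A B x y = (lookup A x ∧ lookup B y) ∨ (lookup B x ∧ lookup A y)

  deleteAB : Graph n → Subset n → Subset n → Graph n
  deleteAB G A B = record
    { adj    = λ x y → adj G x y ∧ not (crossAB A B x y)
    ; sym    = λ x y → cong₂ (λ u v → u ∧ not v) (sym G x y) (cr x y)
    ; irrefl = λ x → cong (λ u → u ∧ not (crossAB A B x x)) (irrefl G x)
    }
    where
    cr : ∀ x y → crossAB A B x y ≡ crossAB A B y x
    cr x y with lookup A x | lookup B x | lookup A y | lookup B y
    ... | false | false | false | false = refl
    ... | false | false | false | true = refl
    ... | false | false | true | false = refl
    ... | false | false | true | true = refl
    ... | false | true | false | false = refl
    ... | false | true | false | true = refl
    ... | false | true | true | false = refl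
    ... | false | true | true | true = refl
    ... | true | false | false | false = refl
    ... | true | false | false | true = refl
    ... | true | false | true | false = refl
    ... | true | false | true | true = refl
    ... | true | true | false | false = refl
    ... | true | true | false | true = refl
    ... | true | true | true | false = refl
    ... | true | true | true | true = refl

  -- induced subgraph G[X], on the same vertex set (vertices outside X isolated)
  induced : Graph n → Subset n → Graph n
  induced G X = record
    { adj    = λ x y → adj G x y ∧ (lookup X x ∧ lookup X y)
    ; sym    = λ x y → cong₂ _∧_ (sym G x y) (∧c (lookup X x) (lookup X y))
    ; irrefl = λ x → cong (λ u → u ∧ (lookup X x ∧ lookup X x)) (irrefl G x)
    }
    where
    ∧c : ∀ a b → (a ∧ b) ≡ (b ∧ a)
    ∧c false false = refl
    ∧c false true  = refl
    ∧c true  false = refl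
    ∧c true  true  = refl

  -- G[X] is a union of (vertex-disjoint) stars: every connected component
  -- of G[X] is a star K_{1,t} (t ≥ 0), i.e. it has a centre c adjacent to
  -- all other vertices of the component, and every edge of the component
  -- is incident with c.
  SameComponent : Graph n → Subset n → Fin n → Fin n → Set
  SameComponent G X x y = x ∈ X × y ∈ X × ∃ λ k → Walk (induced G X) x y k

  UnionOfStars : Graph n → Subset n → Set
  UnionOfStars G X =
    ∀ x → x ∈ X → ∃ λ c → SameComponent G X x c
      × (∀ y → SameComponent G X x y → y ≡ c ⊎ Adj (induced G X) c y)
      × (∀ y z → SameComponent G X x y → Adj (induced G X) y z → y ≡ c ⊎ z ≡ c)

  _∪ₛ_ : Subset n → Subset n → Subset n
  A ∪ₛ B = tabulate λ x → lookup A x ∨ lookup B x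

  PropertyP : Graph n → Subset n → Subset n → Set
  PropertyP H A B =
    ((∀ x y → x ∈ A → y ∈ A → ¬ Adj H x y) × (∀ x y → x ∈ B → y ∈ B → ¬ Adj H x y))
    × (UnionOfStars H (A ∪ₛ B)
       × (∀ b → b ∈ B → ∣ nbhd H b ∩ A ∣ ≤ 1))
    × (∀ x → x ∈ A → ∀ y → ¬ Adj (deleteAB H A B) x y)
    × RobustSapphire (deleteAB H A B) B

  Disjoint : Subset n → Subset n → Set
  Disjoint A B = ∀ x → x ∈ A → x ∉ B

-- Both inclusions of (i) are witnessed by explicit strong 4-cores: (S(H*) ∖ B') ∪ A' is one
-- for H, and (T ∖ A) ∪ S(H*) is one for H* whenever T is one for H. Neighbourhoods differ
-- between H and H* only at A ∪ B. Every H-neighbour of a vertex of A lies in B, and a vertex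
-- of B has at most one neighbour in A, so the neighbours of a vertex of A' are not in B'.
-- The robust sapphire property puts B and its H*-neighbourhood inside S(H*) with degree at
-- least 5; since distinct vertices of B are at distance at least 5, a vertex next to B loses
-- at most one neighbour (its unique neighbour in B) and keeps four. Parts (ii) and (iii)
-- then follow from (i) by chasing neighbours, using B' ⊆ B ⊆ S(H*).
module Submission where

open import Defs hiding (sym)
open import Data.Nat using (ℕ; suc; _≤_; _<_; _+_; z≤n; s≤s; s≤s⁻¹; _≤?_)
open import Data.Nat.Properties using (≤-trans; ≤-reflexive; +-suc; m≤n⇒m≤1+n; <⇒≱; module ≤-Reasoning)
open import Data.Bool using (Bool; true; false; _∧_; _∨_; not)
import Data.Bool.Properties as Bool
open import Data.Fin using (Fin; _≟_)
open import Data.Fin.Properties using (any?; all?)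
open import Data.Fin.Subset using (Subset; _∈_; _∉_; _∩_; _∪_; _-_; ⁅_⁆; ∣_∣; _⊆_; ⊥; inside; outside)
open import Data.Fin.Subset.Properties
  using ( _∈?_; anySubset?; x∈p∩q⁺; x∈p∩q⁻; p⊆q⇒∣p∣≤∣q∣; ∣p∩q∣≤∣p∣; p⊆p∪q; q⊆p∪q; ∣⊥∣≡0
        ; ∣⁅x⁆∣≡1; x∈⁅x⁆; x∈⁅y⁆⇒x≡y; x∈p∧x≢y⇒x∈p-y; x∈p⇒∣p-x∣<∣p∣ )
open import Data.Vec using ([]; _∷_; lookup; tabulate)
open import Data.Vec.Properties using (lookup∘tabulate; []=⇒lookup; lookup⇒[]=)
open import Data.Product using (∃; _×_; _,_; proj₁; proj₂)
open import Data.Sum using (_⊎_; inj₁; inj₂; [_,_]′)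
open import Function using (_∘_; id)
open import Data.Empty using (⊥-elim)
open import Relation.Nullary using (¬_; Dec; yes; no; does; contradiction)
open import Relation.Nullary.Decidable using (¬?; _×-dec_; _⊎-dec_; _→-dec_; dec-true)
open import Relation.Unary using (Pred; Decidable)
open import Function.Bundles using (_⇔_; mk⇔; Equivalence)
open import Relation.Binary.PropositionalEquality using (_≡_; _≢_; refl; sym; trans; cong; cong₂; subst)

private
  variable
    n : ℕ

∈-tabulate⁺ : ∀ (f : Fin n → Bool) {x} → f x ≡ true → x ∈ tabulate f
∈-tabulate⁺ f {x} fx = lookup⇒[]= x (tabulate f) (trans (lookup∘tabulate f x) fx)

∈-tabulate⁻ : ∀ (f : Fin n → Bool) {x} → x ∈ tabulate f → f x ≡ true
∈-tabulate⁻ f {x} x∈f = trans (sym (lookup∘tabulate f x)) ([]=⇒lookup x∈f)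

subsetOf : ∀ {ℓ} {P : Pred (Fin n) ℓ} → Decidable P → Subset n
subsetOf P? = tabulate (does ∘ P?)

module _ {ℓ} {P : Pred (Fin n) ℓ} (P? : Decidable P) where

  ∈-subsetOf⁺ : ∀ {x} → P x → x ∈ subsetOf P?
  ∈-subsetOf⁺ {x} px = ∈-tabulate⁺ (does ∘ P?) (dec-true (P? x) px)

  ∈-subsetOf⁻ : ∀ {x} → x ∈ subsetOf P? → P x
  ∈-subsetOf⁻ {x} x∈P with P? x | ∈-tabulate⁻ (does ∘ P?) x∈P
  ... | yes px | _  = px
  ... | no _   | ()

∣p∪q∣≤∣p∣+∣q∣ : ∀ (p q : Subset n) → ∣ p ∪ q ∣ ≤ ∣ p ∣ + ∣ q ∣
∣p∪q∣≤∣p∣+∣q∣ []            []            = z≤n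
∣p∪q∣≤∣p∣+∣q∣ (outside ∷ p) (outside ∷ q) = ∣p∪q∣≤∣p∣+∣q∣ p q
∣p∪q∣≤∣p∣+∣q∣ (inside  ∷ p) (outside ∷ q) = s≤s (∣p∪q∣≤∣p∣+∣q∣ p q)
∣p∪q∣≤∣p∣+∣q∣ (outside ∷ p) (inside  ∷ q) =
  ≤-trans (s≤s (∣p∪q∣≤∣p∣+∣q∣ p q)) (≤-reflexive (sym (+-suc ∣ p ∣ ∣ q ∣)))
∣p∪q∣≤∣p∣+∣q∣ (inside  ∷ p) (inside  ∷ q) =
  s≤s (≤-trans (m≤n⇒m≤1+n (∣p∪q∣≤∣p∣+∣q∣ p q)) (≤-reflexive (sym (+-suc ∣ p ∣ ∣ q ∣))))

∣p∣≤1⇒x≡y : ∀ {p : Subset n} {x y} → ∣ p ∣ ≤ 1 → x ∈ p → y ∈ p → x ≡ y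
∣p∣≤1⇒x≡y {p = p} {x} {y} ∣p∣≤1 x∈p y∈p with x ≟ y
... | yes x≡y = x≡y
... | no  x≢y = contradiction ∣p∣≤1 (<⇒≱ (≤-trans (s≤s 1≤∣p-x∣) (x∈p⇒∣p-x∣<∣p∣ x∈p)))
  where
  y∈p-x : y ∈ p - x
  y∈p-x = x∈p∧x≢y⇒x∈p-y y∈p (x≢y ∘ sym)
  1≤∣p-x∣ : 1 ≤ ∣ p - x ∣
  1≤∣p-x∣ = ≤-trans (≤-reflexive (sym (∣⁅x⁆∣≡1 y)))
              (p⊆q⇒∣p∣≤∣q∣ λ z∈⁅y⁆ → subst (_∈ p - x) (sym (x∈⁅y⁆⇒x≡y y z∈⁅y⁆)) y∈p-x)

Adj-sym : ∀ (G : Graph n) {x y} → Adj G x y → Adj G y x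
Adj-sym G {x} {y} xy = trans (Graph.sym G y x) xy

Adj? : ∀ (G : Graph n) x y → Dec (Adj G x y)
Adj? G x y = adj G x y Bool.≟ true

Adj⇒∈nbhd : ∀ (G : Graph n) {x y} → Adj G x y → y ∈ nbhd G x
Adj⇒∈nbhd G {x} = ∈-tabulate⁺ (adj G x)

∈nbhd⇒Adj : ∀ (G : Graph n) {x y} → y ∈ nbhd G x → Adj G x y
∈nbhd⇒Adj G {x} = ∈-tabulate⁻ (adj G x)

∣nbhd∩∣-mono : ∀ (G G′ : Graph n) {X Y x} →
               (∀ {y} → Adj G x y → y ∈ X → Adj G′ x y × y ∈ Y) →
               ∣ nbhd G x ∩ X ∣ ≤ ∣ nbhd G′ x ∩ Y ∣
∣nbhd∩∣-mono G G′ {X} f = p⊆q⇒∣p∣≤∣q∣ λ y∈ →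
  let (y∈N , y∈X) = x∈p∩q⁻ (nbhd G _) X y∈
      (xy′ , y∈Y) = f (∈nbhd⇒Adj G y∈N) y∈X
  in x∈p∩q⁺ (Adj⇒∈nbhd G′ xy′ , y∈Y)

deg≤∣nbhd∩∣ : ∀ (G G′ : Graph n) {Y x} →
              (∀ {y} → Adj G x y → Adj G′ x y × y ∈ Y) →
              deg G x ≤ ∣ nbhd G′ x ∩ Y ∣
deg≤∣nbhd∩∣ G G′ f = p⊆q⇒∣p∣≤∣q∣ λ y∈N →
  let (xy′ , y∈Y) = f (∈nbhd⇒Adj G y∈N) in x∈p∩q⁺ (Adj⇒∈nbhd G′ xy′ , y∈Y)

deg≤1+∣nbhd∩∣ : ∀ (G G′ : Graph n) {Y x} b →
                (∀ {y} → Adj G x y → y ≢ b → Adj G′ x y × y ∈ Y) →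
                deg G x ≤ suc ∣ nbhd G′ x ∩ Y ∣
deg≤1+∣nbhd∩∣ G G′ {Y} {x} b f = begin
  deg G x                              ≤⟨ p⊆q⇒∣p∣≤∣q∣ nbhd⊆ ⟩
  ∣ ⁅ b ⁆ ∪ nbhd G′ x ∩ Y ∣            ≤⟨ ∣p∪q∣≤∣p∣+∣q∣ ⁅ b ⁆ _ ⟩
  ∣ ⁅ b ⁆ ∣ + ∣ nbhd G′ x ∩ Y ∣        ≡⟨ cong (_+ ∣ nbhd G′ x ∩ Y ∣) (∣⁅x⁆∣≡1 b) ⟩
  suc ∣ nbhd G′ x ∩ Y ∣                ∎
  where
  open ≤-Reasoning
  nbhd⊆ : nbhd G x ⊆ ⁅ b ⁆ ∪ nbhd G′ x ∩ Y
  nbhd⊆ {y} y∈N with y ≟ b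
  ... | yes refl = p⊆p∪q _ (x∈⁅x⁆ b)
  ... | no  y≢b  = let (xy′ , y∈Y) = f (∈nbhd⇒Adj G y∈N) y≢b
                   in q⊆p∪q ⁅ b ⁆ _ (x∈p∩q⁺ (Adj⇒∈nbhd G′ xy′ , y∈Y))

0<deg⇒∃Adj : ∀ (G : Graph n) {x} → 0 < deg G x → ∃ (Adj G x)
0<deg⇒∃Adj {n} G {x} 0<deg with any? (Adj? G x)
... | yes ∃adj = ∃adj
... | no  ∄adj = contradiction (≤-trans (p⊆q⇒∣p∣≤∣q∣ nbhd⊆⊥) (≤-reflexive (∣⊥∣≡0 n))) (<⇒≱ 0<deg)
  where
  nbhd⊆⊥ : nbhd G x ⊆ ⊥
  nbhd⊆⊥ y∈N = contradiction (_ , ∈nbhd⇒Adj G y∈N) ∄adj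

Strong4Core⇒4≤deg : ∀ (G : Graph n) {X x} → Strong4Core G X → x ∈ X ⊎ N G (_∈ X) x → 4 ≤ deg G x
Strong4Core⇒4≤deg G {X} {x} core x∈X∪N = ≤-trans (core x x∈X∪N) (∣p∩q∣≤∣p∣ (nbhd G x) X)

N? : ∀ (G : Graph n) {X : Fin n → Set} → Decidable X → Decidable (N G X)
N? G X? y = ¬? (X? y) ×-dec any? (λ x → X? x ×-dec Adj? G x y)

∈⊎N-of-Adj : ∀ (G : Graph n) {X : Fin n → Set} → Decidable X →
             ∀ {x y} → X x → Adj G x y → X y ⊎ N G X y
∈⊎N-of-Adj G X? {x} {y} Xx xy with X? y
... | yes Xy = inj₁ Xy
... | no ¬Xy = inj₂ (¬Xy , x , Xx , xy)

Strong4Core? : ∀ (G : Graph n) → Decidable (Strong4Core G)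
Strong4Core? G X = all? λ x → (x ∈? X ⊎-dec N? G (_∈? X) x) →-dec 4 ≤? ∣ nbhd G x ∩ X ∣

S? : ∀ (G : Graph n) → Decidable (S G)
S? G x = anySubset? λ X → Strong4Core? G X ×-dec x ∈? X

coreSet : Graph n → Subset n
coreSet G = subsetOf (S? G)

Strong4Core⊆coreSet : ∀ (G : Graph n) {X} → Strong4Core G X → X ⊆ coreSet G
Strong4Core⊆coreSet G core x∈X = ∈-subsetOf⁺ (S? G) (_ , core , x∈X)

S-isStrong4Core : ∀ (G : Graph n) {x} → S G x ⊎ N G (S G) x → 4 ≤ ∣ nbhd G x ∩ coreSet G ∣
S-isStrong4Core G (inj₁ (X , core , x∈X)) =
  ≤-trans (core _ (inj₁ x∈X)) (∣nbhd∩∣-mono G G λ xy y∈X → xy , Strong4Core⊆coreSet G core y∈X)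
S-isStrong4Core G {x} (inj₂ (¬Sx , z , (X , core , z∈X) , zx)) =
  ≤-trans (core _ (inj₂ (x∉X , z , z∈X , zx)))
    (∣nbhd∩∣-mono G G λ xy y∈X → xy , Strong4Core⊆coreSet G core y∈X)
  where
  x∉X : x ∉ X
  x∉X x∈X = ¬Sx (X , core , x∈X)

DistAtLeast⇒¬Adj² : ∀ (G : Graph n) {d x y z} → 2 < d → DistAtLeast G x z d → Adj G x y → ¬ Adj G y z
DistAtLeast⇒¬Adj² G 2<d far xy yz = far 2 2<d (step xy (step yz here))

module _ (G : Graph n) (A B : Subset n) where

  deleteAB⇒Adj : ∀ {x y} → Adj (deleteAB G A B) x y → Adj G x y
  deleteAB⇒Adj = Bool.∧-conicalˡ _ _

  Adj⇒deleteAB : ∀ {x y} → Adj G x y → ¬ (x ∈ A × y ∈ B) → ¬ (x ∈ B × y ∈ A) → Adj (deleteAB G A B) x y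
  Adj⇒deleteAB xy ¬AB ¬BA = cong₂ (λ u v → u ∧ not v) xy (cong₂ _∨_ (∧≡false ¬AB) (∧≡false ¬BA))
    where
    ∧≡false : ∀ {p q : Subset n} {x y} → ¬ (x ∈ p × y ∈ q) → lookup p x ∧ lookup q y ≡ false
    ∧≡false {p} {q} {x} {y} ¬pq with lookup p x in px | lookup q y in qy
    ... | true  | true  = contradiction (lookup⇒[]= x p px , lookup⇒[]= y q qy) ¬pq
    ... | true  | false = refl
    ... | false | _     = refl

R-transfer : ∀ {S P S* P* A' B' : Set} →
             S ⇔ ((S* × ¬ B') ⊎ A') → P ⇔ (P* ⊎ B') → (B' → S*) →
             (¬ S × ¬ P) ⇔ ((¬ S* × ¬ P*) × ¬ A')
R-transfer S⇔ P⇔ B'⇒S* = mk⇔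
  (λ (¬S , ¬P) → ( (λ s* → ¬S (Equivalence.from S⇔ (inj₁ (s* , ¬P ∘ Equivalence.from P⇔ ∘ inj₂))))
                 , ¬P ∘ Equivalence.from P⇔ ∘ inj₁ )
               , ¬S ∘ Equivalence.from S⇔ ∘ inj₂)
  (λ ((¬S* , ¬P*) , ¬A') → [ ¬S* ∘ proj₁ , ¬A' ]′ ∘ Equivalence.to S⇔
                         , [ ¬P* , ¬S* ∘ B'⇒S* ]′ ∘ Equivalence.to P⇔)

module CrossEdges {n : ℕ} (H : Graph n) (A B : Subset n)
  (A∩B=∅ : Disjoint A B)
  (B-independent : ∀ x y → x ∈ B → y ∈ B → ¬ Adj H x y)
  (B-≤1-nbr-in-A : ∀ b → b ∈ B → ∣ nbhd H b ∩ A ∣ ≤ 1)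
  (A-isolated : ∀ x → x ∈ A → ∀ y → ¬ Adj (deleteAB H A B) x y)
  (core-around-B : ∀ x → x ∈ B ⊎ N (deleteAB H A B) (_∈ B) x →
                   S (deleteAB H A B) x × (∀ y → Adj (deleteAB H A B) x y → S (deleteAB H A B) y)
                   × 5 ≤ deg (deleteAB H A B) x)
  (B-far : ∀ b₁ b₂ → b₁ ∈ B → b₂ ∈ B → b₁ ≢ b₂ → DistAtLeast (deleteAB H A B) b₁ b₂ 5)
  where

  H* : Graph n
  H* = deleteAB H A B

  S* : Fin n → Set
  S* = S H*

  A' : Fin n → Set
  A' x = x ∈ A × 4 ≤ deg H x

  B' : Fin n → Set
  B' = N H (λ x → x ∈ A × ¬ A' x)

  A'? : Decidable A'
  A'? x = x ∈? A ×-dec 4 ≤? deg H x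

  B'? : Decidable B'
  B'? = N? H λ x → x ∈? A ×-dec ¬? (A'? x)

  Adj⇒Adj* : ∀ {x y} → Adj H x y → x ∉ A → y ∉ A → Adj H* x y
  Adj⇒Adj* xy x∉A y∉A = Adj⇒deleteAB H A B xy (x∉A ∘ proj₁) (y∉A ∘ proj₂)

  A-isolatedʳ : ∀ {x y} → y ∈ A → ¬ Adj H* x y
  A-isolatedʳ y∈A = A-isolated _ y∈A _ ∘ Adj-sym H*

  A-nbr∈B : ∀ {a y} → a ∈ A → Adj H a y → y ∈ B
  A-nbr∈B {a} {y} a∈A ay with y ∈? B
  ... | yes y∈B = y∈B
  ... | no  y∉B =
    contradiction (Adj⇒deleteAB H A B ay (y∉B ∘ proj₂) (A∩B=∅ a a∈A ∘ proj₁)) (A-isolated a a∈A y)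

  B∪N[B]⇒nbr∈S* : ∀ {x y} → x ∈ B ⊎ N H* (_∈ B) x → Adj H* x y → S* y
  B∪N[B]⇒nbr∈S* x∈B∪N = proj₁ (proj₂ (core-around-B _ x∈B∪N)) _

  B∪N[B]⇒5≤deg* : ∀ {x} → x ∈ B ⊎ N H* (_∈ B) x → 5 ≤ deg H* x
  B∪N[B]⇒5≤deg* x∈B∪N = proj₂ (proj₂ (core-around-B _ x∈B∪N))

  B⊆S* : ∀ {x} → x ∈ B → S* x
  B⊆S* x∈B = proj₁ (core-around-B _ (inj₁ x∈B))

  A-nbr∈S* : ∀ {a y} → a ∈ A → Adj H a y → S* y
  A-nbr∈S* a∈A ay = B⊆S* (A-nbr∈B a∈A ay)

  B'⊆B : ∀ {x} → B' x → x ∈ B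
  B'⊆B (_ , a , (a∈A , _) , ax) = A-nbr∈B a∈A ax

  B'⊆S* : ∀ {x} → B' x → S* x
  B'⊆S* = B⊆S* ∘ B'⊆B

  S*⇒∉A : ∀ {x} → S* x → x ∉ A
  S*⇒∉A {x} (X , core , x∈X) x∈A =
    let (y , xy) = 0<deg⇒∃Adj H* (≤-trans (s≤s z≤n) (Strong4Core⇒4≤deg H* core (inj₁ x∈X)))
    in A-isolated x x∈A y xy

  A-nbr-unique : ∀ {b a₁ a₂} → b ∈ B → a₁ ∈ A → a₂ ∈ A → Adj H a₁ b → Adj H a₂ b → a₁ ≡ a₂
  A-nbr-unique {b} b∈B a₁∈A a₂∈A a₁b a₂b =
    ∣p∣≤1⇒x≡y (B-≤1-nbr-in-A b b∈B)
      (x∈p∩q⁺ (Adj⇒∈nbhd H (Adj-sym H a₁b) , a₁∈A))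
      (x∈p∩q⁺ (Adj⇒∈nbhd H (Adj-sym H a₂b) , a₂∈A))

  B-common-nbr-unique : ∀ {b₁ b₂ y} → b₁ ∈ B → b₂ ∈ B → Adj H* b₁ y → Adj H* y b₂ → b₁ ≡ b₂
  B-common-nbr-unique {b₁} {b₂} b₁∈B b₂∈B b₁y yb₂ with b₁ ≟ b₂
  ... | yes b₁≡b₂ = b₁≡b₂
  ... | no  b₁≢b₂ = contradiction yb₂
                      (DistAtLeast⇒¬Adj² H* (s≤s (s≤s (s≤s z≤n))) (B-far b₁ b₂ b₁∈B b₂∈B b₁≢b₂) b₁y)

  S*∖B'∪A' : Fin n → Set
  S*∖B'∪A' x = (S* x × ¬ B' x) ⊎ A' x

  S*∖B'∪A'? : Decidable S*∖B'∪A'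
  S*∖B'∪A'? x = (S? H* x ×-dec ¬? (B'? x)) ⊎-dec A'? x

  private
    X : Subset n
    X = subsetOf S*∖B'∪A'?

    ∈X⁺ : ∀ {x} → S*∖B'∪A' x → x ∈ X
    ∈X⁺ = ∈-subsetOf⁺ S*∖B'∪A'?

    ∈X⁻ : ∀ {x} → x ∈ X → S*∖B'∪A' x
    ∈X⁻ = ∈-subsetOf⁻ S*∖B'∪A'?

    A'-bound : ∀ {x} → A' x → 4 ≤ ∣ nbhd H x ∩ X ∣
    A'-bound (x∈A , 4≤deg) =
      ≤-trans 4≤deg (deg≤∣nbhd∩∣ H H λ xy → xy , ∈X⁺ (inj₁ (A-nbr∈S* x∈A xy , ¬B' xy)))
      where
      ¬B' : ∀ {y} → Adj H _ y → ¬ B' y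
      ¬B' xy (_ , a , (a∈A , ¬A'a) , ay) =
        ¬A'a (subst A' (A-nbr-unique (A-nbr∈B x∈A xy) x∈A a∈A xy ay) (x∈A , 4≤deg))

    A∖A'∉X∪N : ∀ {x} → x ∈ A → ¬ A' x → ¬ (x ∈ X ⊎ N H (_∈ X) x)
    A∖A'∉X∪N x∈A ¬A'x (inj₁ x∈X) = [ (λ (S*x , _) → S*⇒∉A S*x x∈A) , ¬A'x ]′ (∈X⁻ x∈X)
    A∖A'∉X∪N {x} x∈A ¬A'x (inj₂ (_ , z , z∈X , zx)) =
      [ (λ (_ , ¬B'z) → ¬B'z B'z) , z∉A ∘ proj₁ ]′ (∈X⁻ z∈X)
      where
      z∉A : z ∉ A
      z∉A z∈A = A∩B=∅ z z∈A (A-nbr∈B x∈A (Adj-sym H zx))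
      B'z : B' z
      B'z = z∉A ∘ proj₁ , x , (x∈A , ¬A'x) , Adj-sym H zx

    -- Of the at least five H*-neighbours of x, only b can lie in B'.
    B-nbr-bound : ∀ {x b} → b ∈ B → Adj H* x b → 4 ≤ ∣ nbhd H x ∩ X ∣
    B-nbr-bound {x} {b} b∈B xb =
      s≤s⁻¹ (≤-trans (B∪N[B]⇒5≤deg* x∈B∪N) (deg≤1+∣nbhd∩∣ H* H b λ xy y≢b →
        deleteAB⇒Adj H A B xy , ∈X⁺ (inj₁ (B∪N[B]⇒nbr∈S* x∈B∪N xy , ¬B' xy y≢b))))
      where
      x∈B∪N : x ∈ B ⊎ N H* (_∈ B) x
      x∈B∪N = inj₂ ( (λ x∈B → B-independent x b x∈B b∈B (deleteAB⇒Adj H A B xb))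
                   , b , b∈B , Adj-sym H* xb )
      ¬B' : ∀ {y} → Adj H* x y → y ≢ b → ¬ B' y
      ¬B' xy y≢b B'y = y≢b (sym (B-common-nbr-unique b∈B (B'⊆B B'y) (Adj-sym H* xb) xy))

    ∉A⇒S*∪N[S*] : ∀ {x} → x ∉ A → x ∈ X ⊎ N H (_∈ X) x → S* x ⊎ N H* S* x
    ∉A⇒S*∪N[S*] x∉A (inj₁ x∈X) = [ inj₁ ∘ proj₁ , ⊥-elim ∘ x∉A ∘ proj₁ ]′ (∈X⁻ x∈X)
    ∉A⇒S*∪N[S*] x∉A (inj₂ (_ , z , z∈X , zx)) with z ∈? A
    ... | yes z∈A = inj₁ (A-nbr∈S* z∈A zx)
    ... | no  z∉A = ∈⊎N-of-Adj H* (S? H*) S*z (Adj⇒Adj* zx z∉A x∉A)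
      where
      S*z : S* z
      S*z = [ proj₁ , ⊥-elim ∘ z∉A ∘ proj₁ ]′ (∈X⁻ z∈X)

    ∉A-bound : ∀ {x} → x ∉ A → x ∈ X ⊎ N H (_∈ X) x → 4 ≤ ∣ nbhd H x ∩ X ∣
    ∉A-bound {x} x∉A x∈X∪N with any? (λ b → b ∈? B ×-dec Adj? H* x b)
    ... | yes (b , b∈B , xb) = B-nbr-bound b∈B xb
    ... | no  ∄b = ≤-trans (S-isStrong4Core H* (∉A⇒S*∪N[S*] x∉A x∈X∪N)) (∣nbhd∩∣-mono H* H λ xy y∈core →
        deleteAB⇒Adj H A B xy , ∈X⁺ (inj₁ (∈-subsetOf⁻ (S? H*) y∈core , λ B'y → ∄b (_ , B'⊆B B'y , xy))))

    X-isStrong4Core : Strong4Core H X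
    X-isStrong4Core x x∈X∪N with x ∈? A | A'? x
    ... | yes _   | yes A'x = A'-bound A'x
    ... | yes x∈A | no ¬A'x = contradiction x∈X∪N (A∖A'∉X∪N x∈A ¬A'x)
    ... | no  x∉A | _       = ∉A-bound x∉A x∈X∪N

  S*∖B'∪A'⇒S : ∀ {x} → S*∖B'∪A' x → S H x
  S*∖B'∪A'⇒S x∈ = X , X-isStrong4Core , ∈X⁺ x∈

  module _ {T : Subset n} (T-core : Strong4Core H T) where
    private
      T∖A∪S* : Fin n → Set
      T∖A∪S* y = (y ∈ T × y ∉ A) ⊎ S* y

      T∖A∪S*? : Decidable T∖A∪S*
      T∖A∪S*? y = (y ∈? T ×-dec ¬? (y ∈? A)) ⊎-dec S? H* y

      Y : Subset n
      Y = subsetOf T∖A∪S*?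

      ∈Y⁺ : ∀ {y} → T∖A∪S* y → y ∈ Y
      ∈Y⁺ = ∈-subsetOf⁺ T∖A∪S*?

      ∈Y⁻ : ∀ {y} → y ∈ Y → T∖A∪S* y
      ∈Y⁻ = ∈-subsetOf⁻ T∖A∪S*?

      S*-bound : ∀ {y} → S* y ⊎ N H* S* y → 4 ≤ ∣ nbhd H* y ∩ Y ∣
      S*-bound y∈S*∪N = ≤-trans (S-isStrong4Core H* y∈S*∪N)
        (∣nbhd∩∣-mono H* H* λ xy y∈core → xy , ∈Y⁺ (inj₂ (∈-subsetOf⁻ (S? H*) y∈core)))

      T-bound : ∀ {y} → y ∉ A → ¬ S* y → y ∈ T ⊎ N H (_∈ T) y → 4 ≤ ∣ nbhd H* y ∩ Y ∣
      T-bound y∉A ¬S*y y∈T∪N = ≤-trans (T-core _ y∈T∪N) (∣nbhd∩∣-mono H H* λ yw w∈T →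
          let w∉A = λ w∈A → ¬S*y (A-nbr∈S* w∈A (Adj-sym H yw))
          in Adj⇒Adj* yw y∉A w∉A , ∈Y⁺ (inj₁ (w∈T , w∉A)))

      Y-isStrong4Core : Strong4Core H* Y
      Y-isStrong4Core y y∈Y∪N with S? H* y | y∈Y∪N
      ... | yes S*y | _ = S*-bound (inj₁ S*y)
      ... | no ¬S*y | inj₁ y∈Y =
        [ (λ (y∈T , y∉A) → T-bound y∉A ¬S*y (inj₁ y∈T)) , ⊥-elim ∘ ¬S*y ]′ (∈Y⁻ y∈Y)
      ... | no ¬S*y | inj₂ (_ , z , z∈Y , zy) =
        [ T∖A-nbr , (λ S*z → S*-bound (inj₂ (¬S*y , z , S*z , zy))) ]′ (∈Y⁻ z∈Y)
        where
        T∖A-nbr : z ∈ T × z ∉ A → 4 ≤ ∣ nbhd H* y ∩ Y ∣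
        T∖A-nbr (z∈T , _) =
          T-bound (λ y∈A → A-isolatedʳ y∈A zy) ¬S*y (∈⊎N-of-Adj H (_∈? T) z∈T (deleteAB⇒Adj H A B zy))

    ∈Strong4Core⇒S*∖B'∪A' : ∀ {x} → x ∈ T → S*∖B'∪A' x
    ∈Strong4Core⇒S*∖B'∪A' {x} x∈T with x ∈? A
    ... | yes x∈A = inj₂ (x∈A , Strong4Core⇒4≤deg H T-core (inj₁ x∈T))
    ... | no  x∉A = inj₁ ((Y , Y-isStrong4Core , ∈Y⁺ (inj₁ (x∈T , x∉A))) , ¬B'x)
      where
      ¬B'x : ¬ B' x
      ¬B'x (_ , a , (a∈A , ¬A'a) , ax) =
        ¬A'a (a∈A , Strong4Core⇒4≤deg H T-core (∈⊎N-of-Adj H (_∈? T) x∈T (Adj-sym H ax)))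

  S⇒S*∖B'∪A' : ∀ {x} → S H x → S*∖B'∪A' x
  S⇒S*∖B'∪A' (T , T-core , x∈T) = ∈Strong4Core⇒S*∖B'∪A' T-core x∈T

  S⇔S*∖B'∪A' : ∀ x → S H x ⇔ S*∖B'∪A' x
  S⇔S*∖B'∪A' x = mk⇔ S⇒S*∖B'∪A' S*∖B'∪A'⇒S

  P⇒P*∪B' : ∀ {x} → P H x → P H* x ⊎ B' x
  P⇒P*∪B' {x} (¬Sx , y , Sy , yx) with B'? x
  ... | yes B'x = inj₂ B'x
  ... | no ¬B'x = inj₁ (¬S*x , y , S*y , Adj⇒Adj* yx (S*⇒∉A S*y) x∉A)
    where
    ¬S*x : ¬ S* x
    ¬S*x S*x = ¬Sx (S*∖B'∪A'⇒S (inj₁ (S*x , ¬B'x)))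
    S*y×¬B'y : S* y × ¬ B' y
    S*y×¬B'y = [ id , (λ (y∈A , _) → ⊥-elim (¬S*x (A-nbr∈S* y∈A yx))) ]′ (S⇒S*∖B'∪A' Sy)
    S*y : S* y
    S*y = proj₁ S*y×¬B'y
    x∉A : x ∉ A
    x∉A x∈A with A'? x
    ... | yes A'x = ¬Sx (S*∖B'∪A'⇒S (inj₂ A'x))
    ... | no ¬A'x = proj₂ S*y×¬B'y (S*⇒∉A S*y ∘ proj₁ , x , (x∈A , ¬A'x) , Adj-sym H yx)

  P*∪B'⇒P : ∀ {x} → P H* x ⊎ B' x → P H x
  P*∪B'⇒P {x} (inj₁ (¬S*x , y , S*y , yx)) =
    ¬Sx , y , S*∖B'∪A'⇒S (inj₁ (S*y , ¬B'y)) , deleteAB⇒Adj H A B yx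
    where
    ¬Sx : ¬ S H x
    ¬Sx Sx = [ ¬S*x ∘ proj₁ , (λ (x∈A , _) → A-isolatedʳ x∈A yx) ]′ (S⇒S*∖B'∪A' Sx)
    ¬B'y : ¬ B' y
    ¬B'y B'y = ¬S*x (B∪N[B]⇒nbr∈S* (inj₁ (B'⊆B B'y)) yx)
  P*∪B'⇒P {x} (inj₂ B'x) with 0<deg⇒∃Adj H* (≤-trans (s≤s z≤n) (B∪N[B]⇒5≤deg* (inj₁ (B'⊆B B'x))))
  ... | y , xy =
    ¬Sx , y , S*∖B'∪A'⇒S (inj₁ (B∪N[B]⇒nbr∈S* (inj₁ x∈B) xy , ¬B'y)) , Adj-sym H (deleteAB⇒Adj H A B xy)
    where
    x∈B : x ∈ B
    x∈B = B'⊆B B'x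
    ¬Sx : ¬ S H x
    ¬Sx Sx = [ (λ (_ , ¬B'x) → ¬B'x B'x) , (λ (x∈A , _) → A∩B=∅ x x∈A x∈B) ]′ (S⇒S*∖B'∪A' Sx)
    ¬B'y : ¬ B' y
    ¬B'y B'y = B-independent x y x∈B (B'⊆B B'y) (deleteAB⇒Adj H A B xy)

  P⇔P*∪B' : ∀ x → P H x ⇔ (P H* x ⊎ B' x)
  P⇔P*∪B' x = mk⇔ P⇒P*∪B' P*∪B'⇒P

proposition6p6 : ∀ {n : ℕ} (H : Graph n) (A B : Subset n)
    → Disjoint A B
    → PropertyP H A B
    → let Hs = deleteAB H A B
          A' = λ (x : Fin n) → x ∈ A × 4 ≤ deg H x
          B' = N H (λ x → x ∈ A × ¬ A' x)
      in (∀ x → S H x ⇔ ((S Hs x × ¬ B' x) ⊎ A' x))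
         × (∀ x → P H x ⇔ (P Hs x ⊎ B' x))
         × (∀ x → R H x ⇔ (R Hs x × ¬ A' x))
proposition6p6 H A B A∩B=∅
  ((_ , B-independent) , (_ , B-≤1-nbr-in-A) , A-isolated , (core-around-B , B-far)) =
  S⇔S*∖B'∪A' , P⇔P*∪B' , λ x → R-transfer (S⇔S*∖B'∪A' x) (P⇔P*∪B' x) B'⊆S*
  where
  open CrossEdges H A B A∩B=∅ B-independent B-≤1-nbr-in-A A-isolated core-around-B B-far
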